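{- The formulae and terms of Stratified Sets, equipped with the rewrite relation $\to$ (the compatible closure of $t\in\{a\mid\phi\}\to\phi[a:=t]$), are confluent and strongly normalising.
   Context: Atoms: for each $i\in\mathbb{Z}$ fix a countably infinite set $\mathbb{A}_i$ of atoms (variable symbols), the $\mathbb{A}_i$ pairwise disjoint; $\mathrm{level}(a)=i$ iff $a\in\mathbb{A}_i$. Syntax: formulae $\phi,\psi::=\bot\mid\neg\phi\mid\phi\wedge\psi\mid\forall a.\phi\mid s\in t$ and terms $s,t::=a\mid\{a\mid\phi\}$, where $\forall a$ and $\{a\mid\cdot\}$ bind $a$ and syntax is taken up to $\alpha$-equivalence; $\phi[a:=s]$, $r[a:=s]$ denote capture-avoiding substitution. Levels extend to terms by $\mathrm{level}(\{a\mid\phi\})=\mathrm{level}(a)+1$. A formula or term is stratified when for every subformula $s'\in s$ occurring in it, $\mathrm{level}(s)=\mathrm{level}(s')+1$. The language of Stratified Sets consists of the stratified formulae and terms (substitutions $[a:=s]$ are only used when $\mathrm{level}(a)=\mathrm{level}(s)$). Rewriting: $\to$ is the least relation containing $t\in\{a\mid\phi\}\to\phi[a:=t]$ and closed under contexts: if $\phi\to\phi'$ then $\neg\phi\to\neg\phi'$, $\phi\wedge\psi\to\phi'\wedge\psi$, $\psi\wedge\phi\to\psi\wedge\phi'$, $\forall a.\phi\to\forall a.\phi'$, $\{a\mid\phi\}\to\{a\mid\phi'\}$; if $s\to s'$ then $t\in s\to t\in s'$ and $s\in t\to s'\in t$. -}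

module Defs where

open import Data.Integer using (ℤ; suc)
open import Data.List using (List; []; _∷_)
open import Data.Product using (Σ; _×_; _,_; ∃)
open import Relation.Binary.Construct.Closure.ReflexiveTransitive using (Star)
open import Induction.WellFounded using (Acc)
open import Function using (flip)

-- Syntax of Stratified Sets, up to α-equivalence, via (intrinsically
-- stratified) de Bruijn syntax.  A context lists the levels of the atoms
-- in scope (free atoms and enclosing binders); a variable of level i is a
-- position in the context carrying level i.
Ctx : Set
Ctx = List ℤ

data Var : Ctx → ℤ → Set where
  here  : ∀ {Γ i} → Var (i ∷ Γ) i
  there : ∀ {Γ i j} → Var Γ i → Var (j ∷ Γ) i

mutual
  data Term (Γ : Ctx) : ℤ → Set where
    var  : ∀ {i} → Var Γ i → Term Γ i
    comp : ∀ {i} → Formula (i ∷ Γ) → Term Γ (suc i)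

  data Formula (Γ : Ctx) : Set where
    bot : Formula Γ
    neg : Formula Γ → Formula Γ
    and : Formula Γ → Formula Γ → Formula Γ
    all : ∀ {i} → Formula (i ∷ Γ) → Formula Γ
    mem : ∀ {i} → Term Γ i → Term Γ (suc i) → Formula Γ

Ren : Ctx → Ctx → Set
Ren Γ Δ = ∀ {i} → Var Γ i → Var Δ i

liftR : ∀ {Γ Δ j} → Ren Γ Δ → Ren (j ∷ Γ) (j ∷ Δ)
liftR ρ here      = here
liftR ρ (there x) = there (ρ x)

mutual
  renT : ∀ {Γ Δ i} → Ren Γ Δ → Term Γ i → Term Δ i
  renT ρ (var x)  = var (ρ x)
  renT ρ (comp φ) = comp (renF (liftR ρ) φ)

  renF : ∀ {Γ Δ} → Ren Γ Δ → Formula Γ → Formula Δ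
  renF ρ bot       = bot
  renF ρ (neg φ)   = neg (renF ρ φ)
  renF ρ (and φ ψ) = and (renF ρ φ) (renF ρ ψ)
  renF ρ (all φ)   = all (renF (liftR ρ) φ)
  renF ρ (mem s t) = mem (renT ρ s) (renT ρ t)

Sub : Ctx → Ctx → Set
Sub Γ Δ = ∀ {i} → Var Γ i → Term Δ i

liftS : ∀ {Γ Δ j} → Sub Γ Δ → Sub (j ∷ Γ) (j ∷ Δ)
liftS σ here      = var here
liftS σ (there x) = renT there (σ x)

mutual
  subT : ∀ {Γ Δ i} → Sub Γ Δ → Term Γ i → Term Δ i
  subT σ (var x)  = σ x
  subT σ (comp φ) = comp (subF (liftS σ) φ)

  subF : ∀ {Γ Δ} → Sub Γ Δ → Formula Γ → Formula Δ
  subF σ bot       = bot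
  subF σ (neg φ)   = neg (subF σ φ)
  subF σ (and φ ψ) = and (subF σ φ) (subF σ ψ)
  subF σ (all φ)   = all (subF (liftS σ) φ)
  subF σ (mem s t) = mem (subT σ s) (subT σ t)

single : ∀ {Γ i} → Term Γ i → Sub (i ∷ Γ) Γ
single t here      = t
single t (there x) = var x

_[_] : ∀ {Γ i} → Formula (i ∷ Γ) → Term Γ i → Formula Γ
φ [ t ] = subF (single t) φ

mutual
  data _⟶F_ {Γ : Ctx} : Formula Γ → Formula Γ → Set where
    β     : ∀ {i} (t : Term Γ i) (φ : Formula (i ∷ Γ)) → mem t (comp φ) ⟶F (φ [ t ])
    negC  : ∀ {φ φ'} → φ ⟶F φ' → neg φ ⟶F neg φ'
    andL  : ∀ {φ φ' ψ} → φ ⟶F φ' → and φ ψ ⟶F and φ' ψ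
    andR  : ∀ {φ φ' ψ} → φ ⟶F φ' → and ψ φ ⟶F and ψ φ'
    allC  : ∀ {i} {φ φ' : Formula (i ∷ Γ)} → φ ⟶F φ' → all φ ⟶F all φ'
    memR  : ∀ {i} {t : Term Γ i} {s s'} → s ⟶T s' → mem t s ⟶F mem t s'
    memL  : ∀ {i} {s s' : Term Γ i} {t} → s ⟶T s' → mem s t ⟶F mem s' t

  data _⟶T_ {Γ : Ctx} : {i : ℤ} → Term Γ i → Term Γ i → Set where
    compC : ∀ {i} {φ φ' : Formula (i ∷ Γ)} → φ ⟶F φ' → comp φ ⟶T comp φ'

Confluent : {A : Set} → (A → A → Set) → Set
Confluent {A} R = ∀ {a b c : A} → Star R a b → Star R a c →
  ∃ λ d → Star R b d × Star R c d

SN : {A : Set} → (A → A → Set) → A → Set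
SN R x = Acc (flip R) x

module Submission where

-- Confluence follows from strong normalisation by Newman's lemma, once
-- local confluence is checked.  The only critical pairs overlap the
-- β-step  t ∈ {a | φ} → φ[a:=t]  with a step inside t or inside φ, and
-- they are closed because rewriting is stable under substitution.
--
-- Strong normalisation is proved by reducibility, with the candidates
-- indexed by level; stratification is exactly what makes this index
-- well founded.  Fix a floor b below the level of the left-hand side of
-- every membership in the formula at hand, and measure a level i by its
-- height  lv b i = max 0 (i - b).  A term of height 0 is reducible when
-- it is strongly normalising (under every renaming); a comprehension of
-- height n+1 is reducible when, moreover, s ∈ {a | φ} is strongly
-- normalising for all reducible s of height n.  The fundamental lemma
-- (every reducible substitution instance of a formula with floor b is
-- strongly normalising) is then proved by induction on syntax.

open import Defs
open import Data.Integer as ℤ using (ℤ; +_; -[1+_]; _-_; _≤_; _⊓_; +≤+)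
import Data.Integer.Properties as ℤ
open import Data.Nat using (ℕ; zero; suc; pred)
open import Data.List using (_∷_)
open import Data.Product using (_×_; _,_; ∃)
open import Data.Unit using (⊤; tt)
open import Function using (flip; _∘_)
open import Induction.WellFounded using (Acc; acc; acc-inverse)
open import Relation.Binary.PropositionalEquality hiding ([_])
open import Relation.Binary.Construct.Closure.ReflexiveTransitive
  using (Star; ε; _◅_; _◅◅_; gmap)
open import Relation.Binary.Rewriting using (WeaklyConfluent)
open import Axiom.UniquenessOfIdentityProofs using (module Decidable⇒UIP)

-- Each fusion law is stated
-- for an arbitrary third map agreeing pointwise with the composite, which
-- is the form that goes under binders (the lift-* cases).

mutual
  renT-renT : ∀ {Γ Δ Θ i} (ρ : Ren Δ Θ) (ρ' : Ren Γ Δ) (ρ'' : Ren Γ Θ) →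
    (∀ {j} (x : Var Γ j) → ρ (ρ' x) ≡ ρ'' x) →
    (t : Term Γ i) → renT ρ (renT ρ' t) ≡ renT ρ'' t
  renT-renT ρ ρ' ρ'' h (var x)  = cong var (h x)
  renT-renT ρ ρ' ρ'' h (comp φ) = cong comp (renF-renF _ _ _ (lift-rr h) φ)

  renF-renF : ∀ {Γ Δ Θ} (ρ : Ren Δ Θ) (ρ' : Ren Γ Δ) (ρ'' : Ren Γ Θ) →
    (∀ {j} (x : Var Γ j) → ρ (ρ' x) ≡ ρ'' x) →
    (φ : Formula Γ) → renF ρ (renF ρ' φ) ≡ renF ρ'' φ
  renF-renF ρ ρ' ρ'' h bot       = refl
  renF-renF ρ ρ' ρ'' h (neg φ)   = cong neg (renF-renF ρ ρ' ρ'' h φ)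
  renF-renF ρ ρ' ρ'' h (and φ ψ) = cong₂ and (renF-renF ρ ρ' ρ'' h φ) (renF-renF ρ ρ' ρ'' h ψ)
  renF-renF ρ ρ' ρ'' h (all φ)   = cong all (renF-renF _ _ _ (lift-rr h) φ)
  renF-renF ρ ρ' ρ'' h (mem s t) = cong₂ mem (renT-renT ρ ρ' ρ'' h s) (renT-renT ρ ρ' ρ'' h t)

  lift-rr : ∀ {Γ Δ Θ k} {ρ : Ren Δ Θ} {ρ' : Ren Γ Δ} {ρ'' : Ren Γ Θ} →
    (∀ {j} (x : Var Γ j) → ρ (ρ' x) ≡ ρ'' x) →
    ∀ {j} (x : Var (k ∷ Γ) j) → liftR ρ (liftR ρ' x) ≡ liftR ρ'' x
  lift-rr h here      = refl
  lift-rr h (there x) = cong there (h x)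

mutual
  renT-subT : ∀ {Γ Δ Θ i} (ρ : Ren Δ Θ) (σ : Sub Γ Δ) (σ' : Sub Γ Θ) →
    (∀ {j} (x : Var Γ j) → renT ρ (σ x) ≡ σ' x) →
    (t : Term Γ i) → renT ρ (subT σ t) ≡ subT σ' t
  renT-subT ρ σ σ' h (var x)  = h x
  renT-subT ρ σ σ' h (comp φ) = cong comp (renF-subF _ _ _ (lift-rs h) φ)

  renF-subF : ∀ {Γ Δ Θ} (ρ : Ren Δ Θ) (σ : Sub Γ Δ) (σ' : Sub Γ Θ) →
    (∀ {j} (x : Var Γ j) → renT ρ (σ x) ≡ σ' x) →
    (φ : Formula Γ) → renF ρ (subF σ φ) ≡ subF σ' φ
  renF-subF ρ σ σ' h bot       = refl
  renF-subF ρ σ σ' h (neg φ)   = cong neg (renF-subF ρ σ σ' h φ)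
  renF-subF ρ σ σ' h (and φ ψ) = cong₂ and (renF-subF ρ σ σ' h φ) (renF-subF ρ σ σ' h ψ)
  renF-subF ρ σ σ' h (all φ)   = cong all (renF-subF _ _ _ (lift-rs h) φ)
  renF-subF ρ σ σ' h (mem s t) = cong₂ mem (renT-subT ρ σ σ' h s) (renT-subT ρ σ σ' h t)

  lift-rs : ∀ {Γ Δ Θ k} {ρ : Ren Δ Θ} {σ : Sub Γ Δ} {σ' : Sub Γ Θ} →
    (∀ {j} (x : Var Γ j) → renT ρ (σ x) ≡ σ' x) →
    ∀ {j} (x : Var (k ∷ Γ) j) → renT (liftR ρ) (liftS σ x) ≡ liftS σ' x
  lift-rs h here = refl
  lift-rs {ρ = ρ} {σ} {σ'} h (there x) = begin
    renT (liftR ρ) (renT there (σ x))  ≡⟨ renT-renT _ _ (there ∘ ρ) (λ _ → refl) (σ x) ⟩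
    renT (there ∘ ρ) (σ x)             ≡⟨ renT-renT there ρ _ (λ _ → refl) (σ x) ⟨
    renT there (renT ρ (σ x))          ≡⟨ cong (renT there) (h x) ⟩
    renT there (σ' x)                  ∎
    where open ≡-Reasoning

mutual
  subT-renT : ∀ {Γ Δ Θ i} (σ : Sub Δ Θ) (ρ : Ren Γ Δ) (σ' : Sub Γ Θ) →
    (∀ {j} (x : Var Γ j) → σ (ρ x) ≡ σ' x) →
    (t : Term Γ i) → subT σ (renT ρ t) ≡ subT σ' t
  subT-renT σ ρ σ' h (var x)  = h x
  subT-renT σ ρ σ' h (comp φ) = cong comp (subF-renF _ _ _ (lift-sr h) φ)

  subF-renF : ∀ {Γ Δ Θ} (σ : Sub Δ Θ) (ρ : Ren Γ Δ) (σ' : Sub Γ Θ) →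
    (∀ {j} (x : Var Γ j) → σ (ρ x) ≡ σ' x) →
    (φ : Formula Γ) → subF σ (renF ρ φ) ≡ subF σ' φ
  subF-renF σ ρ σ' h bot       = refl
  subF-renF σ ρ σ' h (neg φ)   = cong neg (subF-renF σ ρ σ' h φ)
  subF-renF σ ρ σ' h (and φ ψ) = cong₂ and (subF-renF σ ρ σ' h φ) (subF-renF σ ρ σ' h ψ)
  subF-renF σ ρ σ' h (all φ)   = cong all (subF-renF _ _ _ (lift-sr h) φ)
  subF-renF σ ρ σ' h (mem s t) = cong₂ mem (subT-renT σ ρ σ' h s) (subT-renT σ ρ σ' h t)

  lift-sr : ∀ {Γ Δ Θ k} {σ : Sub Δ Θ} {ρ : Ren Γ Δ} {σ' : Sub Γ Θ} →
    (∀ {j} (x : Var Γ j) → σ (ρ x) ≡ σ' x) →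
    ∀ {j} (x : Var (k ∷ Γ) j) → liftS σ (liftR ρ x) ≡ liftS σ' x
  lift-sr h here      = refl
  lift-sr h (there x) = cong (renT there) (h x)

mutual
  subT-subT : ∀ {Γ Δ Θ i} (σ : Sub Δ Θ) (τ : Sub Γ Δ) (σ' : Sub Γ Θ) →
    (∀ {j} (x : Var Γ j) → subT σ (τ x) ≡ σ' x) →
    (t : Term Γ i) → subT σ (subT τ t) ≡ subT σ' t
  subT-subT σ τ σ' h (var x)  = h x
  subT-subT σ τ σ' h (comp φ) = cong comp (subF-subF _ _ _ (lift-ss h) φ)

  subF-subF : ∀ {Γ Δ Θ} (σ : Sub Δ Θ) (τ : Sub Γ Δ) (σ' : Sub Γ Θ) →
    (∀ {j} (x : Var Γ j) → subT σ (τ x) ≡ σ' x) →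
    (φ : Formula Γ) → subF σ (subF τ φ) ≡ subF σ' φ
  subF-subF σ τ σ' h bot       = refl
  subF-subF σ τ σ' h (neg φ)   = cong neg (subF-subF σ τ σ' h φ)
  subF-subF σ τ σ' h (and φ ψ) = cong₂ and (subF-subF σ τ σ' h φ) (subF-subF σ τ σ' h ψ)
  subF-subF σ τ σ' h (all φ)   = cong all (subF-subF _ _ _ (lift-ss h) φ)
  subF-subF σ τ σ' h (mem s t) = cong₂ mem (subT-subT σ τ σ' h s) (subT-subT σ τ σ' h t)

  lift-ss : ∀ {Γ Δ Θ k} {σ : Sub Δ Θ} {τ : Sub Γ Δ} {σ' : Sub Γ Θ} →
    (∀ {j} (x : Var Γ j) → subT σ (τ x) ≡ σ' x) →
    ∀ {j} (x : Var (k ∷ Γ) j) → subT (liftS σ) (liftS τ x) ≡ liftS σ' x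
  lift-ss h here = refl
  lift-ss {σ = σ} {τ} {σ'} h (there x) = begin
    subT (liftS σ) (renT there (τ x))  ≡⟨ subT-renT _ there (renT there ∘ σ) (λ _ → refl) (τ x) ⟩
    subT (renT there ∘ σ) (τ x)        ≡⟨ renT-subT there σ _ (λ _ → refl) (τ x) ⟨
    renT there (subT σ (τ x))          ≡⟨ cong (renT there) (h x) ⟩
    renT there (σ' x)                  ∎
    where open ≡-Reasoning

mutual
  subT-id : ∀ {Γ i} (σ : Sub Γ Γ) → (∀ {j} (x : Var Γ j) → σ x ≡ var x) →
    (t : Term Γ i) → subT σ t ≡ t
  subT-id σ h (var x)  = h x
  subT-id σ h (comp φ) = cong comp (subF-id _ (lift-id h) φ)

  subF-id : ∀ {Γ} (σ : Sub Γ Γ) → (∀ {j} (x : Var Γ j) → σ x ≡ var x) →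
    (φ : Formula Γ) → subF σ φ ≡ φ
  subF-id σ h bot       = refl
  subF-id σ h (neg φ)   = cong neg (subF-id σ h φ)
  subF-id σ h (and φ ψ) = cong₂ and (subF-id σ h φ) (subF-id σ h ψ)
  subF-id σ h (all φ)   = cong all (subF-id _ (lift-id h) φ)
  subF-id σ h (mem s t) = cong₂ mem (subT-id σ h s) (subT-id σ h t)

  lift-id : ∀ {Γ k} {σ : Sub Γ Γ} → (∀ {j} (x : Var Γ j) → σ x ≡ var x) →
    ∀ {j} (x : Var (k ∷ Γ) j) → liftS σ x ≡ var x
  lift-id h here      = refl
  lift-id h (there x) = cong (renT there) (h x)

renT≡subT : ∀ {Γ Δ i} (ρ : Ren Γ Δ) (t : Term Γ i) → renT ρ t ≡ subT (var ∘ ρ) t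
renT≡subT ρ t = trans (cong (renT ρ) (sym (subT-id var (λ _ → refl) t)))
                      (renT-subT ρ var _ (λ _ → refl) t)

renF≡subF : ∀ {Γ Δ} (ρ : Ren Γ Δ) (φ : Formula Γ) → renF ρ φ ≡ subF (var ∘ ρ) φ
renF≡subF ρ φ = trans (cong (renF ρ) (sym (subF-id var (λ _ → refl) φ)))
                      (renF-subF ρ var _ (λ _ → refl) φ)

renT-id : ∀ {Γ i} (t : Term Γ i) → renT (λ x → x) t ≡ t
renT-id t = trans (renT≡subT (λ x → x) t) (subT-id var (λ _ → refl) t)

extend : ∀ {Γ Δ k} → Term Δ k → Sub Γ Δ → Sub (k ∷ Γ) Δ
extend u σ here      = u
extend u σ (there x) = σ x

weaken-[] : ∀ {Γ i k} (u : Term Γ k) (t : Term Γ i) → subT (single u) (renT there t) ≡ t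
weaken-[] u t = trans (subT-renT (single u) there var (λ _ → refl) t)
                      (subT-id var (λ _ → refl) t)

liftS-[] : ∀ {Γ Δ k} (σ : Sub Γ Δ) (u : Term Δ k) (φ : Formula (k ∷ Γ)) →
  subF (liftS σ) φ [ u ] ≡ subF (extend u σ) φ
liftS-[] σ u = subF-subF (single u) (liftS σ) (extend u σ) instantiate
  where
  instantiate : ∀ {j} (x : Var _ j) → subT (single u) (liftS σ x) ≡ extend u σ x
  instantiate here      = refl
  instantiate (there x) = weaken-[] u (σ x)

renF-liftS : ∀ {Γ Δ Θ k} (ρ : Ren Δ Θ) (σ : Sub Γ Δ) (φ : Formula (k ∷ Γ)) →
  renF (liftR ρ) (subF (liftS σ) φ) ≡ subF (liftS (renT ρ ∘ σ)) φ
renF-liftS ρ σ = renF-subF (liftR ρ) (liftS σ) _ (lift-rs (λ _ → refl))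

subF-[] : ∀ {Γ Δ i} (σ : Sub Γ Δ) (t : Term Γ i) (φ : Formula (i ∷ Γ)) →
  subF σ (φ [ t ]) ≡ subF (liftS σ) φ [ subT σ t ]
subF-[] σ t φ = trans (subF-subF σ (single t) (extend (subT σ t) σ) pointwise φ)
                      (sym (liftS-[] σ (subT σ t) φ))
  where
  pointwise : ∀ {j} (x : Var _ j) → subT σ (single t x) ≡ extend (subT σ t) σ x
  pointwise here      = refl
  pointwise (there x) = refl

mutual
  subF-step : ∀ {Γ Δ} (σ : Sub Γ Δ) {φ φ' : Formula Γ} → φ ⟶F φ' → subF σ φ ⟶F subF σ φ'
  subF-step σ (β t φ) = subst (mem (subT σ t) (comp (subF (liftS σ) φ)) ⟶F_)
                              (sym (subF-[] σ t φ)) (β (subT σ t) (subF (liftS σ) φ))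
  subF-step σ (negC r) = negC (subF-step σ r)
  subF-step σ (andL r) = andL (subF-step σ r)
  subF-step σ (andR r) = andR (subF-step σ r)
  subF-step σ (allC r) = allC (subF-step (liftS σ) r)
  subF-step σ (memR r) = memR (subT-step σ r)
  subF-step σ (memL r) = memL (subT-step σ r)

  subT-step : ∀ {Γ Δ i} (σ : Sub Γ Δ) {t t' : Term Γ i} → t ⟶T t' → subT σ t ⟶T subT σ t'
  subT-step σ (compC r) = compC (subF-step (liftS σ) r)

renF-step : ∀ {Γ Δ} (ρ : Ren Γ Δ) {φ φ' : Formula Γ} → φ ⟶F φ' → renF ρ φ ⟶F renF ρ φ'
renF-step ρ {φ} {φ'} r = subst₂ _⟶F_ (sym (renF≡subF ρ φ)) (sym (renF≡subF ρ φ')) (subF-step _ r)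

renT-step : ∀ {Γ Δ i} (ρ : Ren Γ Δ) {t t' : Term Γ i} → t ⟶T t' → renT ρ t ⟶T renT ρ t'
renT-step ρ (compC r) = compC (renF-step (liftR ρ) r)

mutual
  subF-star : ∀ {Γ Δ} (σ σ' : Sub Γ Δ) → (∀ {j} (x : Var Γ j) → Star _⟶T_ (σ x) (σ' x)) →
    (φ : Formula Γ) → Star _⟶F_ (subF σ φ) (subF σ' φ)
  subF-star σ σ' h bot       = ε
  subF-star σ σ' h (neg φ)   = gmap neg negC (subF-star σ σ' h φ)
  subF-star σ σ' h (and φ ψ) = gmap (λ χ → and χ (subF σ ψ)) andL (subF-star σ σ' h φ)
                           ◅◅ gmap (and (subF σ' φ)) andR (subF-star σ σ' h ψ)
  subF-star σ σ' h (all φ)   = gmap all allC (subF-star _ _ (lift-star h) φ)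
  subF-star σ σ' h (mem s t) = gmap (λ r → mem r (subT σ t)) memL (subT-star σ σ' h s)
                           ◅◅ gmap (mem (subT σ' s)) memR (subT-star σ σ' h t)

  subT-star : ∀ {Γ Δ i} (σ σ' : Sub Γ Δ) → (∀ {j} (x : Var Γ j) → Star _⟶T_ (σ x) (σ' x)) →
    (t : Term Γ i) → Star _⟶T_ (subT σ t) (subT σ' t)
  subT-star σ σ' h (var x)  = h x
  subT-star σ σ' h (comp φ) = gmap comp compC (subF-star _ _ (lift-star h) φ)

  lift-star : ∀ {Γ Δ k} {σ σ' : Sub Γ Δ} → (∀ {j} (x : Var Γ j) → Star _⟶T_ (σ x) (σ' x)) →
    ∀ {j} (x : Var (k ∷ Γ) j) → Star _⟶T_ (liftS σ x) (liftS σ' x)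
  lift-star h here      = ε
  lift-star h (there x) = gmap (renT there) (renT-step there) (h x)

[]-star : ∀ {Γ i} (φ : Formula (i ∷ Γ)) {t t' : Term Γ i} → t ⟶T t' →
  Star _⟶F_ (φ [ t ]) (φ [ t' ])
[]-star φ {t} {t'} r = subF-star (single t) (single t') pointwise φ
  where
  pointwise : ∀ {j} (x : Var _ j) → Star _⟶T_ (single t x) (single t' x)
  pointwise here      = r ◅ ε
  pointwise (there x) = ε

-- Steps in disjoint positions commute in one step each;
-- a β-step against a step inside its argument or its body is closed by
-- []-star resp. subF-step; steps in the same position follow by induction.

mutual
  lcF : ∀ {Γ} → WeaklyConfluent (_⟶F_ {Γ})
  lcF (β t φ) (β .t .φ)                            = _ , ε , ε
  lcF (β t φ) (memL {s' = t'} r)                   = φ [ t' ] , []-star φ r , β t' φ ◅ ε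
  lcF (β t φ) (memR (compC {φ' = φ'} r))           = φ' [ t ] , subF-step (single t) r ◅ ε , β t φ' ◅ ε
  lcF (memL {s' = t'} r) (β t φ)                   = φ [ t' ] , β t' φ ◅ ε , []-star φ r
  lcF (memR (compC {φ' = φ'} r)) (β t φ)           = φ' [ t ] , β t φ' ◅ ε , subF-step (single t) r ◅ ε
  lcF (negC r) (negC r') with lcF r r'
  ... | χ , p , q = neg χ , gmap neg negC p , gmap neg negC q
  lcF (andL r) (andL r') with lcF r r'
  ... | χ , p , q = _ , gmap (λ ξ → and ξ _) andL p , gmap (λ ξ → and ξ _) andL q
  lcF (andL r) (andR r') = _ , andR r' ◅ ε , andL r ◅ ε
  lcF (andR r) (andL r') = _ , andL r' ◅ ε , andR r ◅ ε
  lcF (andR r) (andR r') with lcF r r'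
  ... | χ , p , q = _ , gmap (and _) andR p , gmap (and _) andR q
  lcF (allC r) (allC r') with lcF r r'
  ... | χ , p , q = all χ , gmap all allC p , gmap all allC q
  lcF (memR r) (memR r') with lcT r r'
  ... | u , p , q = _ , gmap (mem _) memR p , gmap (mem _) memR q
  lcF (memR r) (memL r') = _ , memL r' ◅ ε , memR r ◅ ε
  lcF (memL r) (memR r') = _ , memR r' ◅ ε , memL r ◅ ε
  lcF (memL r) (memL r') with lcT r r'
  ... | u , p , q = _ , gmap (λ v → mem v _) memL p , gmap (λ v → mem v _) memL q

  lcT : ∀ {Γ i} → WeaklyConfluent (_⟶T_ {Γ} {i})
  lcT (compC r) (compC r') with lcF r r'
  ... | χ , p , q = comp χ , gmap comp compC p , gmap comp compC q

-- Newman's lemma, from accessibility of the starting point only (the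
-- library's  sn&wcr⇒cr  asks for well-foundedness of the whole relation).
newman : {A : Set} {R : A → A → Set} → WeaklyConfluent R →
  ∀ {a} → Acc (flip R) a → ∀ {b c} → Star R a b → Star R a c →
  ∃ λ d → Star R b d × Star R c d
newman lc _ ε q = _ , q , ε
newman lc _ (r ◅ p) ε = _ , ε , r ◅ p
newman lc (acc sn) (r ◅ p) (r' ◅ q) with lc r r'
... | d , rd , r'd with newman lc (sn r) p rd
... | e , pe , de with newman lc (sn r') q (r'd ◅◅ de)
... | f , qf , ef = f , pe ◅◅ ef , qf

confluent : {A : Set} {R : A → A → Set} → WeaklyConfluent R →
  ((a : A) → SN R a) → Confluent R
confluent lc sn {a} = newman lc (sn a)

SNF : ∀ {Γ} → Formula Γ → Set
SNF = SN _⟶F_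

SNT : ∀ {Γ i} → Term Γ i → Set
SNT = SN _⟶T_

snBot : ∀ {Γ} → SNF (bot {Γ})
snBot = acc λ ()

snVar : ∀ {Γ i} (x : Var Γ i) → SNT (var x)
snVar x = acc λ ()

snNeg : ∀ {Γ} {φ : Formula Γ} → SNF φ → SNF (neg φ)
snNeg (acc sn) = acc λ { (negC r) → snNeg (sn r) }

snAnd : ∀ {Γ} {φ ψ : Formula Γ} → SNF φ → SNF ψ → SNF (and φ ψ)
snAnd snφ@(acc sn) snψ@(acc sn') =
  acc λ { (andL r) → snAnd (sn r) snψ ; (andR r) → snAnd snφ (sn' r) }

snAll : ∀ {Γ i} {φ : Formula (i ∷ Γ)} → SNF φ → SNF (all φ)
snAll (acc sn) = acc λ { (allC r) → snAll (sn r) }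

snComp : ∀ {Γ i} {φ : Formula (i ∷ Γ)} → SNF φ → SNT (comp φ)
snComp (acc sn) = acc λ { (compC r) → snComp (sn r) }

-- A membership in a variable has no redex at its root.
snMemVar : ∀ {Γ i} {u : Term Γ i} (x : Var Γ (ℤ.suc i)) → SNT u → SNF (mem u (var x))
snMemVar x (acc sn) = acc λ { (memL r) → snMemVar x (sn r) }

snMemComp : ∀ {Δ j} (P : Term Δ j → Set) → (∀ {u u'} → P u → u ⟶T u' → P u') →
  (ψ : Formula (j ∷ Δ)) → SNF ψ → (∀ u → P u → SNF (ψ [ u ])) →
  (u : Term Δ j) → P u → SNT u → SNF (mem u (comp ψ))
snMemComp P P-step ψ snψ@(acc snψ') inst u pu snu@(acc snu') = acc reduct
  where
  reduct : ∀ {χ} → mem u (comp ψ) ⟶F χ → SNF χ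
  reduct (β _ _)              = inst u pu
  reduct (memL u⟶u')          = snMemComp P P-step ψ snψ inst _ (P-step pu u⟶u') (snu' u⟶u')
  reduct (memR (compC ψ⟶ψ')) = snMemComp P P-step _ (snψ' ψ⟶ψ')
    (λ u' pu' → acc-inverse (inst u' pu') (subF-step (single u') ψ⟶ψ')) u pu snu

-- Strong normalisation under every renaming (a Kripke-style strengthening
-- that makes closure under weakening immediate).
SN⁺ : ∀ {Γ i} → Term Γ i → Set
SN⁺ {Γ} t = ∀ {Δ} (ρ : Ren Γ Δ) → SNT (renT ρ t)

sn⁺⇒sn : ∀ {Γ i} {t : Term Γ i} → SN⁺ t → SNT t
sn⁺⇒sn {t = t} sn = subst SNT (renT-id t) (sn (λ x → x))

sn⁺-ren : ∀ {Γ Δ i} {t : Term Γ i} (ρ : Ren Γ Δ) → SN⁺ t → SN⁺ (renT ρ t)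
sn⁺-ren {t = t} ρ sn ρ' = subst SNT (sym (renT-renT ρ' ρ _ (λ _ → refl) t)) (sn (ρ' ∘ ρ))

sn⁺-step : ∀ {Γ i} {t t' : Term Γ i} → SN⁺ t → t ⟶T t' → SN⁺ t'
sn⁺-step sn r ρ = acc-inverse (sn ρ) (renT-step ρ r)

clamp : ℤ → ℕ
clamp (+ n)    = n
clamp -[1+ n ] = 0

lv : ℤ → ℤ → ℕ
lv b i = clamp (i - b)

suc-minus : ∀ j b → ℤ.suc j - b ≡ ℤ.suc (j - b)
suc-minus j b = ℤ.+-assoc (+ 1) j (ℤ.- b)

lv-pred : ∀ b j → lv b j ≡ pred (lv b (ℤ.suc j))
lv-pred b j = trans (clamp-pred (j - b)) (cong (pred ∘ clamp) (sym (suc-minus j b)))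
  where
  clamp-pred : ∀ z → clamp z ≡ pred (clamp (ℤ.suc z))
  clamp-pred (+ n)        = refl
  clamp-pred -[1+ zero ]  = refl
  clamp-pred -[1+ suc n ] = refl

lv-suc : ∀ {b j} → b ≤ j → lv b (ℤ.suc j) ≡ suc (lv b j)
lv-suc {b} {j} b≤j = trans (cong clamp (suc-minus j b)) (clamp-suc (ℤ.i≤j⇒0≤j-i b≤j))
  where
  clamp-suc : ∀ {z} → + 0 ≤ z → clamp (ℤ.suc z) ≡ suc (clamp z)
  clamp-suc (+≤+ _) = refl

mutual
  FloorT : ℤ → ∀ {Γ i} → Term Γ i → Set
  FloorT b (var x)  = ⊤
  FloorT b (comp φ) = FloorF b φ

  FloorF : ℤ → ∀ {Γ} → Formula Γ → Set
  FloorF b bot           = ⊤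
  FloorF b (neg φ)       = FloorF b φ
  FloorF b (and φ ψ)     = FloorF b φ × FloorF b ψ
  FloorF b (all φ)       = FloorF b φ
  FloorF b (mem {i} s t) = b ≤ i × FloorT b s × FloorT b t

mutual
  lowerT : ∀ {b b' Γ i} → b' ≤ b → (t : Term Γ i) → FloorT b t → FloorT b' t
  lowerT b'≤b (var x)  _ = tt
  lowerT b'≤b (comp φ) f = lowerF b'≤b φ f

  lowerF : ∀ {b b' Γ} → b' ≤ b → (φ : Formula Γ) → FloorF b φ → FloorF b' φ
  lowerF b'≤b bot       _              = tt
  lowerF b'≤b (neg φ)   f              = lowerF b'≤b φ f
  lowerF b'≤b (and φ ψ) (fφ , fψ)      = lowerF b'≤b φ fφ , lowerF b'≤b ψ fψ
  lowerF b'≤b (all φ)   f              = lowerF b'≤b φ f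
  lowerF b'≤b (mem s t) (b≤i , fs , ft) =
    ℤ.≤-trans b'≤b b≤i , lowerT b'≤b s fs , lowerT b'≤b t ft

mutual
  floorT : ∀ {Γ i} → Term Γ i → ℤ
  floorT (var x)  = + 0
  floorT (comp φ) = floorF φ

  floorF : ∀ {Γ} → Formula Γ → ℤ
  floorF bot           = + 0
  floorF (neg φ)       = floorF φ
  floorF (and φ ψ)     = floorF φ ⊓ floorF ψ
  floorF (all φ)       = floorF φ
  floorF (mem {i} s t) = i ⊓ (floorT s ⊓ floorT t)

mutual
  floorT-floor : ∀ {Γ i} (t : Term Γ i) → FloorT (floorT t) t
  floorT-floor (var x)  = tt
  floorT-floor (comp φ) = floorF-floor φ

  floorF-floor : ∀ {Γ} (φ : Formula Γ) → FloorF (floorF φ) φ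
  floorF-floor bot       = tt
  floorF-floor (neg φ)   = floorF-floor φ
  floorF-floor (and φ ψ) =
      lowerF (ℤ.i⊓j≤i (floorF φ) (floorF ψ)) φ (floorF-floor φ)
    , lowerF (ℤ.i⊓j≤j (floorF φ) (floorF ψ)) ψ (floorF-floor ψ)
  floorF-floor (all φ)   = floorF-floor φ
  floorF-floor (mem {i} s t) =
      ℤ.i⊓j≤i i _
    , lowerT (ℤ.≤-trans below (ℤ.i⊓j≤i _ _)) s (floorT-floor s)
    , lowerT (ℤ.≤-trans below (ℤ.i⊓j≤j _ _)) t (floorT-floor t)
    where
    below : i ⊓ (floorT s ⊓ floorT t) ≤ floorT s ⊓ floorT t
    below = ℤ.i⊓j≤j i _

Red : ℕ → ∀ {Γ i} → Term Γ i → Set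
Red zero            t            = SN⁺ t
Red (suc n)         (var x)      = ⊤
Red (suc n) {Γ} (comp {i} φ) = SN⁺ (comp φ) ×
  (∀ {Δ} (ρ : Ren Γ Δ) (u : Term Δ i) → Red n u → SNF (mem u (renT ρ (comp φ))))

red⇒sn⁺ : ∀ n {Γ i} (t : Term Γ i) → Red n t → SN⁺ t
red⇒sn⁺ zero    t        sn       = sn
red⇒sn⁺ (suc n) (var x)  _        = λ ρ → snVar (ρ x)
red⇒sn⁺ (suc n) (comp φ) (sn , _) = sn

red⇒sn : ∀ n {Γ i} {t : Term Γ i} → Red n t → SNT t
red⇒sn n {t = t} red = sn⁺⇒sn (red⇒sn⁺ n t red)

redVar : ∀ n {Γ i} (x : Var Γ i) → Red n (var x)
redVar zero    x = λ ρ → snVar (ρ x)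
redVar (suc n) x = tt

redRen : ∀ n {Γ Δ i} (ρ : Ren Γ Δ) (t : Term Γ i) → Red n t → Red n (renT ρ t)
redRen zero    ρ t        sn           = sn⁺-ren ρ sn
redRen (suc n) ρ (var x)  _            = tt
redRen (suc n) ρ (comp φ) (sn , memSN) = sn⁺-ren ρ sn , λ ρ' u red →
  subst (λ s → SNF (mem u s)) (sym (renT-renT ρ' ρ _ (λ _ → refl) (comp φ)))
    (memSN (ρ' ∘ ρ) u red)

redStep : ∀ n {Γ i} {t t' : Term Γ i} → Red n t → t ⟶T t' → Red n t'
redStep zero    sn           r         = sn⁺-step sn r
redStep (suc n) (sn , memSN) (compC r) = sn⁺-step sn (compC r) , λ ρ u red →
  acc-inverse (memSN ρ u red) (memR (renT-step ρ (compC r)))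

-- A term of successor level is a variable or a comprehension.  (The level
-- index ℤ.suc i is not a constructor pattern, so this needs injectivity of
-- ℤ.suc and uniqueness of identity proofs on ℤ, which has decidable equality.)
data SucLevelView {Γ i} : Term Γ (ℤ.suc i) → Set where
  isVar  : (x : Var Γ (ℤ.suc i)) → SucLevelView (var x)
  isComp : (φ : Formula (i ∷ Γ)) → SucLevelView (comp φ)

sucLevelView : ∀ {Γ i} (t : Term Γ (ℤ.suc i)) → SucLevelView {Γ} {i} t
sucLevelView t = view t refl
  where
  suc-injective : ∀ {i j} → ℤ.suc i ≡ ℤ.suc j → i ≡ j
  suc-injective {i} {j} eq =
    trans (sym (ℤ.pred-suc i)) (trans (cong ℤ.pred eq) (ℤ.pred-suc j))

  view : ∀ {Γ i k} (t : Term Γ k) (eq : k ≡ ℤ.suc i) → SucLevelView {Γ} {i} (subst (Term Γ) eq t)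
  view (var x) refl = isVar x
  view {i = i} (comp {j} φ) eq with suc-injective {j} {i} eq
  ... | refl rewrite Decidable⇒UIP.≡-irrelevant ℤ._≟_ eq refl = isComp φ

redMem : ∀ n {Γ i} {u : Term Γ i} (t : Term Γ (ℤ.suc i)) → Red (suc n) t → Red n u → SNF (mem u t)
redMem n {i = i} t redt redu with sucLevelView {i = i} t
redMem n         _ _            redu | isVar x  = snMemVar x (red⇒sn n redu)
redMem n {u = u} _ (_ , memSN) redu | isComp φ =
  subst (λ s → SNF (mem u s)) (renT-id (comp φ)) (memSN (λ x → x) u redu)

redComp : ∀ n {Γ i} (φ : Formula (i ∷ Γ)) →
  (∀ {Δ} (ρ : Ren Γ Δ) → SNF (renF (liftR ρ) φ)) →
  (∀ {Δ} (ρ : Ren Γ Δ) (u : Term Δ i) → Red (pred n) u → SNF (renF (liftR ρ) φ [ u ])) →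
  Red n (comp φ)
redComp zero    φ sn inst = λ ρ → snComp (sn ρ)
redComp (suc n) φ sn inst = (λ ρ → snComp (sn ρ)) , λ ρ u red →
  snMemComp (Red n) (redStep n) _ (sn ρ) (inst ρ) u red (red⇒sn n red)

module Fundamental (b : ℤ) where

  RedSub : ∀ {Γ Δ} → Sub Γ Δ → Set
  RedSub {Γ} σ = ∀ {i} (x : Var Γ i) → Red (lv b i) (σ x)

  redSub-var : ∀ {Γ} → RedSub {Γ} var
  redSub-var x = redVar _ x

  redSub-ren : ∀ {Γ Δ Θ} {σ : Sub Γ Δ} (ρ : Ren Δ Θ) → RedSub σ → RedSub (renT ρ ∘ σ)
  redSub-ren ρ red x = redRen _ ρ _ (red x)

  redSub-lift : ∀ {Γ Δ k} {σ : Sub Γ Δ} → RedSub σ → RedSub (liftS {j = k} σ)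
  redSub-lift red here      = redVar _ here
  redSub-lift red (there x) = redRen _ there _ (red x)

  redSub-extend : ∀ {Γ Δ k} {u : Term Δ k} {σ : Sub Γ Δ} →
    Red (lv b k) u → RedSub σ → RedSub (extend u σ)
  redSub-extend redu red here      = redu
  redSub-extend redu red (there x) = red x

  mutual
    fundF : ∀ {Γ Δ} (φ : Formula Γ) → FloorF b φ → (σ : Sub Γ Δ) → RedSub σ → SNF (subF σ φ)
    fundF bot       _         σ red = snBot
    fundF (neg φ)   f         σ red = snNeg (fundF φ f σ red)
    fundF (and φ ψ) (fφ , fψ) σ red = snAnd (fundF φ fφ σ red) (fundF ψ fψ σ red)
    fundF (all φ)   f         σ red = snAll (fundF φ f (liftS σ) (redSub-lift red))
    fundF (mem {j} s t) (b≤j , fs , ft) σ red =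
      redMem (lv b j) (subT σ t) (subst (λ n → Red n (subT σ t)) (lv-suc b≤j) (fundT t ft σ red))
        (fundT s fs σ red)

    fundT : ∀ {Γ Δ i} (t : Term Γ i) → FloorT b t → (σ : Sub Γ Δ) → RedSub σ → Red (lv b i) (subT σ t)
    fundT (var x)      _ σ red = red x
    fundT (comp {j} φ) f σ red = redComp (lv b (ℤ.suc j)) (subF (liftS σ) φ) body inst
      where
      body : ∀ {Θ} (ρ : Ren _ Θ) → SNF (renF (liftR ρ) (subF (liftS σ) φ))
      body ρ = subst SNF (sym (renF-liftS ρ σ φ))
        (fundF φ f (liftS (renT ρ ∘ σ)) (redSub-lift (redSub-ren ρ red)))

      -- the height of u is one less than that of {a | φ}, as lv-pred says
      inst : ∀ {Θ} (ρ : Ren _ Θ) (u : Term Θ j) → Red (pred (lv b (ℤ.suc j))) u →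
        SNF (renF (liftR ρ) (subF (liftS σ) φ) [ u ])
      inst ρ u redu = subst SNF instance≡
        (fundF φ f (extend u (renT ρ ∘ σ))
          (redSub-extend (subst (λ n → Red n u) (sym (lv-pred b j)) redu) (redSub-ren ρ red)))
        where
        instance≡ : subF (extend u (renT ρ ∘ σ)) φ ≡ renF (liftR ρ) (subF (liftS σ) φ) [ u ]
        instance≡ = sym (trans (cong (_[ u ]) (renF-liftS ρ σ φ)) (liftS-[] (renT ρ ∘ σ) u φ))

snF : (Γ : Ctx) (φ : Formula Γ) → SN _⟶F_ φ
snF Γ φ = subst SNF (subF-id var (λ _ → refl) φ)
  (fundF φ (floorF-floor φ) var redSub-var)
  where open Fundamental (floorF φ)

snT : (Γ : Ctx) (i : ℤ) (t : Term Γ i) → SN _⟶T_ t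
snT Γ i (var x)  = snVar x
snT Γ i (comp φ) = snComp (snF _ φ)

theorem5p30 : ((Γ : Ctx) → Confluent (_⟶F_ {Γ}))
            × ((Γ : Ctx) (i : ℤ) → Confluent (_⟶T_ {Γ} {i}))
            × ((Γ : Ctx) (φ : Formula Γ) → SN _⟶F_ φ)
            × ((Γ : Ctx) (i : ℤ) (t : Term Γ i) → SN _⟶T_ t)
theorem5p30 = (λ Γ → confluent lcF (snF Γ))
            , (λ Γ i → confluent lcT (snT Γ i))
            , snF
            , snT
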